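{- $\mathbf{RCie}$ is a logic of formal inconsistency (LFI); in particular it is paraconsistent. The same holds for $\mathbf{RCbr}$.
   Context: Formulas are built from a denumerable set of propositional variables using binary $\wedge,\vee,\rightarrow$ and unary $\neg,\circ$; $\alpha\leftrightarrow\beta$ abbreviates $(\alpha\rightarrow\beta)\wedge(\beta\rightarrow\alpha)$. The logic $\mathbf{Cbr}$ is the Hilbert calculus with modus ponens as only rule and axiom schemas: (1) $\alpha\rightarrow(\beta\rightarrow\alpha)$; (2) $(\alpha\rightarrow(\beta\rightarrow\gamma))\rightarrow((\alpha\rightarrow\beta)\rightarrow(\alpha\rightarrow\gamma))$; (3) $\alpha\rightarrow(\beta\rightarrow(\alpha\wedge\beta))$; (4) $(\alpha\wedge\beta)\rightarrow\alpha$; (5) $(\alpha\wedge\beta)\rightarrow\beta$; (6) $\alpha\rightarrow(\alpha\vee\beta)$; (7) $\beta\rightarrow(\alpha\vee\beta)$; (8) $(\alpha\rightarrow\gamma)\rightarrow((\beta\rightarrow\gamma)\rightarrow((\alpha\vee\beta)\rightarrow\gamma))$; (9) $(\alpha\rightarrow\beta)\vee\alpha$; (10) $\alpha\vee\neg\alpha$; (11) $\circ\alpha\rightarrow(\alpha\rightarrow(\neg\alpha\rightarrow\beta))$; (12) $\circ\alpha\vee(\alpha\wedge\neg\alpha)$; (13) $\alpha\rightarrow\neg\neg\alpha$; (14) $\neg\neg\alpha\rightarrow\alpha$. $\mathbf{Cie}$ is obtained from $\mathbf{Cbr}$ by replacing (12) with $\neg\circ\alpha\rightarrow(\alpha\wedge\neg\alpha)$.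 For $\mathbf{L}\in\{\mathbf{Cbr},\mathbf{Cie}\}$, $\mathbf{RL}$ is obtained from $\mathbf{L}$ by adding the rules "from $\alpha\leftrightarrow\beta$ infer $\neg\alpha\leftrightarrow\neg\beta$" and "from $\alpha\leftrightarrow\beta$ infer $\circ\alpha\leftrightarrow\circ\beta$", which apply only to theorems: $\vdash_{\mathbf{RL}}\alpha$ means $\alpha$ has a derivation (without premises) in this calculus, and for a set $\Gamma$ of formulas, $\Gamma\vdash_{\mathbf{RL}}\alpha$ means that either $\vdash_{\mathbf{RL}}\alpha$ or there are $\gamma_1,\dots,\gamma_n\in\Gamma$ with $\vdash_{\mathbf{RL}}(\gamma_1\wedge\dots\wedge\gamma_n)\rightarrow\alpha$. A logic $\mathbf{L}$ with these connectives is an LFI (with respect to $\neg$ and $\circ$) if: for some formulas $\varphi,\psi$, $\varphi,\neg\varphi\nvdash_{\mathbf{L}}\psi$ (paraconsistency); for some $\varphi,\psi$, $\circ\varphi,\varphi\nvdash_{\mathbf{L}}\psi$; for some $\varphi,\psi$, $\circ\varphi,\neg\varphi\nvdash_{\mathbf{L}}\psi$; and $\circ\varphi,\varphi,\neg\varphi\vdash_{\mathbf{L}}\psi$ for all $\varphi,\psi$. -}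

module Defs where

open import Data.Nat using (ℕ)
open import Data.List using (List; []; _∷_)
open import Data.List.NonEmpty using (List⁺; _∷_; toList)
open import Data.List.Relation.Unary.All using (All)
open import Data.List.Membership.Propositional using (_∈_)
open import Data.Product using (Σ; _×_; ∃)
open import Data.Sum using (_⊎_)
open import Relation.Nullary using (¬_)

infixr 20 ~_ ∘_
infixl 15 _∧_
infixl 14 _∨_
infixr 13 _⇒_ _⇔_

data Form : Set where
  var : ℕ → Form
  _∧_ _∨_ _⇒_ : Form → Form → Form
  ~_ ∘_ : Form → Form

_⇔_ : Form → Form → Form
α ⇔ β = (α ⇒ β) ∧ (β ⇒ α)

data Base : Set where
  Cbr Cie : Base

ax12-instance : Base → Form → Form
ax12-instance Cbr α = ∘ α ∨ (α ∧ ~ α)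
ax12-instance Cie α = ~ (∘ α) ⇒ (α ∧ ~ α)

data ⊢R (L : Base) : Form → Set where
  ax1  : ∀ α β → ⊢R L (α ⇒ (β ⇒ α))
  ax2  : ∀ α β γ → ⊢R L ((α ⇒ (β ⇒ γ)) ⇒ ((α ⇒ β) ⇒ (α ⇒ γ)))
  ax3  : ∀ α β → ⊢R L (α ⇒ (β ⇒ (α ∧ β)))
  ax4  : ∀ α β → ⊢R L ((α ∧ β) ⇒ α)
  ax5  : ∀ α β → ⊢R L ((α ∧ β) ⇒ β)
  ax6  : ∀ α β → ⊢R L (α ⇒ (α ∨ β))
  ax7  : ∀ α β → ⊢R L (β ⇒ (α ∨ β))
  ax8  : ∀ α β γ → ⊢R L ((α ⇒ γ) ⇒ ((β ⇒ γ) ⇒ ((α ∨ β) ⇒ γ)))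
  ax9  : ∀ α β → ⊢R L ((α ⇒ β) ∨ α)
  ax10 : ∀ α → ⊢R L (α ∨ ~ α)
  ax11 : ∀ α β → ⊢R L (∘ α ⇒ (α ⇒ (~ α ⇒ β)))
  ax12 : ∀ α → ⊢R L (ax12-instance L α)
  ax13 : ∀ α → ⊢R L (α ⇒ ~ ~ α)
  ax14 : ∀ α → ⊢R L (~ ~ α ⇒ α)
  mp   : ∀ {α β} → ⊢R L α → ⊢R L (α ⇒ β) → ⊢R L β
  rule¬ : ∀ {α β} → ⊢R L (α ⇔ β) → ⊢R L (~ α ⇔ ~ β)
  rule∘ : ∀ {α β} → ⊢R L (α ⇔ β) → ⊢R L (∘ α ⇔ ∘ β)

conj′ : Form → List Form → Form
conj′ γ []       = γ
conj′ γ (δ ∷ γs) = γ ∧ conj′ δ γs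

conj : List⁺ Form → Form
conj (γ ∷ γs) = conj′ γ γs

_⊢[_]_ : List Form → Base → Form → Set
Γ ⊢[ L ] α = ⊢R L α ⊎ Σ (List⁺ Form) (λ γs → All (_∈ Γ) (toList γs) × ⊢R L (conj γs ⇒ α))

IsLFI : Base → Set
IsLFI L =
    Σ Form (λ φ → Σ Form (λ ψ → ¬ ((φ ∷ ~ φ ∷ []) ⊢[ L ] ψ)))
  × Σ Form (λ φ → Σ Form (λ ψ → ¬ ((∘ φ ∷ φ ∷ []) ⊢[ L ] ψ)))
  × Σ Form (λ φ → Σ Form (λ ψ → ¬ ((∘ φ ∷ ~ φ ∷ []) ⊢[ L ] ψ)))
  × (∀ φ ψ → (∘ φ ∷ φ ∷ ~ φ ∷ []) ⊢[ L ] ψ)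

{-# OPTIONS --safe #-}
-- Both logics are sound for a classical model whose truth values are sets of integers
-- and whose designated value is ℤ. The rays ↑ e = [e, ∞) and ↓ e = (-∞, e] are negated
-- into each other, overlapping exactly at their common endpoint; every other set is
-- negated by complement. The complement of a ray is a ray, so this negation is an
-- involution; ∘ X, the complement of X ∩ ~ X, misses at most one point, so it is never a
-- ray and ~ ∘ X = X ∩ ~ X, which is the Cie axiom. Negation is a function of the set,
-- so the replacement rules are sound. Interpreting p as ↑ 0, the points 0, 1 and -1
-- refute p, ~ p ⊢ q, then ∘ p, p ⊢ q, then ∘ p, ~ p ⊢ q.
-- Some infinite chain is unavoidable: if ~ X ≠ ∁ X then ∁ (~ X) is a strictly smaller set
-- with the same property, so no finite Boolean algebra carries such a negation.
-- Sets are predicates read through double negation: x holds when every point is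
-- ¬¬-in x, and x ≈ y is classical equality of sets.
module Submission where

open import Defs
open import Data.Product using (_×_; _,_; proj₁; proj₂; Σ; ∃)
import Data.Product as Product
open import Data.Sum using (_⊎_; inj₁; inj₂; [_,_]; swap)
import Data.Sum as Sum
open import Data.Nat using (ℕ; z≤n)
open import Data.Integer using (ℤ; +_; -[1+_]; _≤_; +≤+; suc; pred)
open import Data.Integer.Properties
  using ( ≤-refl; ≤-reflexive; ≤-trans; ≤-antisym; _≤?_; _≟_; ≰⇒>; <⇒≤; <⇒≱; <⇒≢; <-irrefl
        ; i≤suc[i]; i≢suc[i]; suc[i]≤j⇒i<j; i<j⇒suc[i]≤j; i≤pred[j]⇒i<j; i<j⇒i≤pred[j]
        ; i≤j⇒pred[i]≤j )
open import Data.List using ([]; _∷_)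
open import Data.List.NonEmpty using (_∷_)
open import Data.List.Relation.Unary.All using (All; []; _∷_)
import Data.List.Relation.Unary.All as All
open import Level using (0ℓ)
open import Relation.Binary.Bundles using (Setoid)
open import Relation.Binary.PropositionalEquality using (_≡_; _≢_; refl)
open import Relation.Nullary.Decidable using (yes; no; toSum; decidable-stable; ¬¬-excluded-middle)
open import Relation.Nullary.Negation
  using (¬_; contradiction; contraposition; negated-stable; stable; ¬¬-map; ¬¬-Monad)
open import Relation.Unary using (Pred; ∁; _∩_; _∪_; ∅) renaming (_⇒_ to _⇒ᵘ_)
open import Effect.Monad using (RawMonad)
open RawMonad (¬¬-Monad {0ℓ}) using (pure; _<$>_; _<*>_; _>>=_)

private
  variable
    A : Set
    a b e m : ℤ

Value : Set₁
Value = Pred ℤ 0ℓ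

private
  variable
    x x′ y y′ z : Value

¬¬-lem : ¬ ¬ (A ⊎ ¬ A)
¬¬-lem = ¬¬-map toSum ¬¬-excluded-middle

≤-stable : ¬ ¬ (a ≤ b) → a ≤ b
≤-stable {a} {b} = decidable-stable (a ≤? b)

Holds : Value → Set
Holds x = ∀ m → ¬ ¬ x m

infix 4 _≈_
_≈_ : Value → Value → Set
x ≈ y = Holds ((x ⇒ᵘ y) ∩ (y ⇒ᵘ x))

≈⇒⊆ : x ≈ y → x m → ¬ ¬ y m
≈⇒⊆ {m = m} x≈y xm = ¬¬-map (λ (f , _) → f xm) (x≈y m)

≈⇒⊇ : x ≈ y → y m → ¬ ¬ x m
≈⇒⊇ {m = m} x≈y ym = ¬¬-map (λ (_ , g) → g ym) (x≈y m)

≈-refl : x ≈ x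
≈-refl m = pure ((λ xm → xm) , (λ xm → xm))

≈-sym : x ≈ y → y ≈ x
≈-sym x≈y m = Product.swap <$> x≈y m

≈-trans : x ≈ y → y ≈ z → x ≈ z
≈-trans x≈y y≈z m = do
  (f , f′) ← x≈y m
  (g , g′) ← y≈z m
  pure ((λ xm → g (f xm)) , (λ zm → f′ (g′ zm)))

≈-setoid : Setoid (Level.suc 0ℓ) 0ℓ
≈-setoid = record
  { Carrier = Value
  ; _≈_ = _≈_
  ; isEquivalence = record { refl = ≈-refl ; sym = ≈-sym ; trans = ≈-trans }
  }

open import Relation.Binary.Reasoning.Setoid ≈-setoid

∩-cong : x ≈ x′ → y ≈ y′ → x ∩ y ≈ x′ ∩ y′
∩-cong x≈x′ y≈y′ m =
  (λ (f , f′) (g , g′) → Product.map f g , Product.map f′ g′) <$> x≈x′ m <*> y≈y′ m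

∁-cong : x ≈ y → ∁ x ≈ ∁ y
∁-cong x≈y m = ¬¬-map (λ (f , g) → contraposition g , contraposition f) (x≈y m)

∁-involutive : ∁ (∁ x) ≈ x
∁-involutive m = ¬¬-map (λ ¬¬xm→xm → ¬¬xm→xm , λ xm ¬xm → ¬xm xm) stable

↑_ : ℤ → Value
↑ e = e ≤_

↓_ : ℤ → Value
↓ e = _≤ e

∁-↑ : ∁ (↑ e) ≈ ↓ pred e
∁-↑ m = pure ((λ e≰m → i<j⇒i≤pred[j] (≰⇒> e≰m)) , (λ m≤pred[e] → <⇒≱ (i≤pred[j]⇒i<j m≤pred[e])))

∁-↓ : ∁ (↓ e) ≈ ↑ suc e
∁-↓ m = pure ((λ m≰e → i<j⇒suc[i]≤j (≰⇒> m≰e)) , (λ suc[e]≤m → <⇒≱ (suc[i]≤j⇒i<j suc[e]≤m)))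

↑-injective : ↑ a ≈ ↑ b → a ≡ b
↑-injective ↑a≈↑b = ≤-antisym (≤-stable (≈⇒⊇ ↑a≈↑b ≤-refl)) (≤-stable (≈⇒⊆ ↑a≈↑b ≤-refl))

↓-injective : ↓ a ≈ ↓ b → a ≡ b
↓-injective ↓a≈↓b = ≤-antisym (≤-stable (≈⇒⊆ ↓a≈↓b ≤-refl)) (≤-stable (≈⇒⊇ ↓a≈↓b ≤-refl))

↑≉↓ : ¬ (↑ a ≈ ↓ b)
↑≉↓ {a} {b} ↑a≈↓b = ≈⇒⊆ ↑a≈↓b (≤-trans a≤b (i≤suc[i] b)) suc[b]≰b
  where
  a≤b : a ≤ b
  a≤b = ≤-stable (≈⇒⊆ ↑a≈↓b ≤-refl)
  suc[b]≰b : ¬ (suc b ≤ b)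
  suc[b]≰b suc[b]≤b = <-irrefl refl (suc[i]≤j⇒i<j suc[b]≤b)

RayAt : Value → ℤ → Set
RayAt x e = x ≈ ↑ e ⊎ x ≈ ↓ e

Ray : Value → Set
Ray x = ∃ (RayAt x)

rayAt-cong : x ≈ y → RayAt x e → RayAt y e
rayAt-cong x≈y = Sum.map (≈-trans (≈-sym x≈y)) (≈-trans (≈-sym x≈y))

ray-cong : x ≈ y → Ray x → Ray y
ray-cong x≈y = Product.map₂ (rayAt-cong x≈y)

rayAt-unique : RayAt x a → RayAt x b → a ≡ b
rayAt-unique (inj₁ x≈↑a) (inj₁ x≈↑b) = ↑-injective (≈-trans (≈-sym x≈↑a) x≈↑b)
rayAt-unique (inj₁ x≈↑a) (inj₂ x≈↓b) = contradiction (≈-trans (≈-sym x≈↑a) x≈↓b) ↑≉↓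
rayAt-unique (inj₂ x≈↓a) (inj₁ x≈↑b) = contradiction (≈-trans (≈-sym x≈↑b) x≈↓a) ↑≉↓
rayAt-unique (inj₂ x≈↓a) (inj₂ x≈↓b) = ↓-injective (≈-trans (≈-sym x≈↓a) x≈↓b)

ray-has-two-points : Ray x → Σ ℤ λ a → Σ ℤ λ b → a ≢ b × ¬ ¬ x a × ¬ ¬ x b
ray-has-two-points (e , inj₁ x≈↑e) =
  e , suc e , i≢suc[i] , ≈⇒⊇ x≈↑e ≤-refl , ≈⇒⊇ x≈↑e (i≤suc[i] e)
ray-has-two-points (e , inj₂ x≈↓e) =
  pred e , e , <⇒≢ (i≤pred[j]⇒i<j ≤-refl) , ≈⇒⊇ x≈↓e (i≤j⇒pred[i]≤j ≤-refl) , ≈⇒⊇ x≈↓e ≤-refl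

∁-ray : Ray x → Ray (∁ x)
∁-ray (e , inj₁ x≈↑e) = pred e , inj₂ (≈-trans (∁-cong x≈↑e) ∁-↑)
∁-ray (e , inj₂ x≈↓e) = suc e , inj₁ (≈-trans (∁-cong x≈↓e) ∁-↓)

∁-nonray : ¬ Ray x → ¬ Ray (∁ x)
∁-nonray ¬ray r = ¬ray (ray-cong ∁-involutive (∁-ray r))

neg : Value → Value
neg x = ∁ x ∪ RayAt x

cons : Value → Value
cons x = ∁ (x ∩ neg x)

neg-cong : x ≈ y → neg x ≈ neg y
neg-cong x≈y m = ¬¬-map
  (λ (f , g) → Sum.map (contraposition g) (rayAt-cong x≈y) , Sum.map (contraposition f) (rayAt-cong (≈-sym x≈y)))
  (x≈y m)

cons-cong : x ≈ y → cons x ≈ cons y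
cons-cong x≈y = ∁-cong (∩-cong x≈y (neg-cong x≈y))

neg-↑ : neg (↑ e) ≈ ↓ e
neg-↑ {e} m = pure (to , from)
  where
  to : neg (↑ e) m → m ≤ e
  to (inj₁ e≰m) = <⇒≤ (≰⇒> e≰m)
  to (inj₂ ray) = ≤-reflexive (rayAt-unique ray (inj₁ ≈-refl))
  from : m ≤ e → neg (↑ e) m
  from m≤e with m ≟ e
  ... | yes refl = inj₂ (inj₁ ≈-refl)
  ... | no m≢e = inj₁ (λ e≤m → m≢e (≤-antisym m≤e e≤m))

neg-↓ : neg (↓ e) ≈ ↑ e
neg-↓ {e} m = pure (to , from)
  where
  to : neg (↓ e) m → e ≤ m
  to (inj₁ m≰e) = <⇒≤ (≰⇒> m≰e)
  to (inj₂ ray) = ≤-reflexive (rayAt-unique (inj₂ ≈-refl) ray)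
  from : e ≤ m → neg (↓ e) m
  from e≤m with m ≟ e
  ... | yes refl = inj₂ (inj₂ ≈-refl)
  ... | no m≢e = inj₁ (λ m≤e → m≢e (≤-antisym m≤e e≤m))

neg-nonray : ¬ Ray x → neg x ≈ ∁ x
neg-nonray ¬ray m = pure ([ (λ ¬xm → ¬xm) , (λ r → contradiction (m , r) ¬ray) ] , inj₁)

neg-involutive : neg (neg x) ≈ x
neg-involutive {x} m = ¬¬-lem >>= λ ray? → by-cases ray? m
  where
  by-cases : Ray x ⊎ ¬ Ray x → neg (neg x) ≈ x
  by-cases (inj₁ (e , inj₁ x≈↑e)) = begin
    neg (neg x)      ≈⟨ neg-cong (neg-cong x≈↑e) ⟩
    neg (neg (↑ e))  ≈⟨ neg-cong neg-↑ ⟩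
    neg (↓ e)        ≈⟨ neg-↓ ⟩
    ↑ e              ≈⟨ ≈-sym x≈↑e ⟩
    x                ∎
  by-cases (inj₁ (e , inj₂ x≈↓e)) = begin
    neg (neg x)      ≈⟨ neg-cong (neg-cong x≈↓e) ⟩
    neg (neg (↓ e))  ≈⟨ neg-cong neg-↓ ⟩
    neg (↑ e)        ≈⟨ neg-↑ ⟩
    ↓ e              ≈⟨ ≈-sym x≈↓e ⟩
    x                ∎
  by-cases (inj₂ ¬ray) = begin
    neg (neg x)  ≈⟨ neg-nonray (λ r → ∁-nonray ¬ray (ray-cong (neg-nonray ¬ray) r)) ⟩
    ∁ (neg x)    ≈⟨ ∁-cong (neg-nonray ¬ray) ⟩
    ∁ (∁ x)      ≈⟨ ∁-involutive ⟩
    x            ∎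

glut⇒rayAt : (x ∩ neg x) m → RayAt x m
glut⇒rayAt (xm , neg-xm) = [ contradiction xm , (λ r → r) ] neg-xm

cons-nonray : ¬ Ray (cons x)
cons-nonray r with ray-has-two-points (∁-ray r)
... | a , b , a≢b , a-glut , b-glut =
  (rayAt-unique <$> rayAt-at a-glut <*> rayAt-at b-glut) a≢b
  where
  rayAt-at : ¬ ¬ ∁ (cons x) m → ¬ ¬ RayAt x m
  rayAt-at glut = ¬¬-map glut⇒rayAt (negated-stable glut)

neg-cons : neg (cons x) ≈ x ∩ neg x
neg-cons {x} = begin
  neg (cons x)        ≈⟨ neg-nonray cons-nonray ⟩
  ∁ (∁ (x ∩ neg x))   ≈⟨ ∁-involutive ⟩
  x ∩ neg x           ∎

⟦_⟧ : Form → (ℕ → Value) → Value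
⟦ var n ⟧ ρ = ρ n
⟦ α ∧ β ⟧ ρ = ⟦ α ⟧ ρ ∩ ⟦ β ⟧ ρ
⟦ α ∨ β ⟧ ρ = ⟦ α ⟧ ρ ∪ ⟦ β ⟧ ρ
⟦ α ⇒ β ⟧ ρ = ⟦ α ⟧ ρ ⇒ᵘ ⟦ β ⟧ ρ
⟦ ~ α ⟧ ρ = neg (⟦ α ⟧ ρ)
⟦ ∘ α ⟧ ρ = cons (⟦ α ⟧ ρ)

private
  variable
    L : Base
    α β γ : Form

sound : ⊢R L α → ∀ ρ → Holds (⟦ α ⟧ ρ)
sound (ax1 α β) ρ m = pure (λ a _ → a)
sound (ax2 α β γ) ρ m = pure (λ f g a → f a (g a))
sound (ax3 α β) ρ m = pure _,_
sound (ax4 α β) ρ m = pure proj₁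
sound (ax5 α β) ρ m = pure proj₂
sound (ax6 α β) ρ m = pure inj₁
sound (ax7 α β) ρ m = pure inj₂
sound (ax8 α β γ) ρ m = pure [_,_]
sound (ax9 α β) ρ m = ¬¬-map (λ a⊎¬a → swap (Sum.map₂ (λ ¬a a → contradiction a ¬a) a⊎¬a)) ¬¬-lem
sound (ax10 α) ρ m = ¬¬-map (Sum.map₂ inj₁) ¬¬-lem
sound (ax11 α β) ρ m = pure (λ ∘a a ~a → contradiction (a , ~a) ∘a)
sound {Cbr} (ax12 α) ρ m = ¬¬-map swap ¬¬-lem
sound {Cie} (ax12 α) ρ m = ¬¬-map proj₁ (neg-cons m)
sound (ax13 α) ρ m = ¬¬-map proj₂ (neg-involutive m)
sound (ax14 α) ρ m = ¬¬-map proj₁ (neg-involutive m)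
sound (mp ⊢α ⊢α⇒β) ρ m = sound ⊢α⇒β ρ m <*> sound ⊢α ρ m
sound (rule¬ ⊢α⇔β) ρ = neg-cong (sound ⊢α⇔β ρ)
sound (rule∘ ⊢α⇔β) ρ = cons-cong (sound ⊢α⇔β ρ)

conj-sat : ∀ {ρ δs} → All (λ δ → ⟦ δ ⟧ ρ m) (γ ∷ δs) → ⟦ conj′ γ δs ⟧ ρ m
conj-sat (sat ∷ []) = sat
conj-sat (sat ∷ sats@(_ ∷ _)) = sat , conj-sat sats

countermodel⇒⊬ : ∀ {Γ ψ} ρ m → All (λ γ → ⟦ γ ⟧ ρ m) Γ → ¬ ⟦ ψ ⟧ ρ m → ¬ (Γ ⊢[ L ] ψ)
countermodel⇒⊬ ρ m Γ-sat ¬ψ (inj₁ ⊢ψ) = sound ⊢ψ ρ m ¬ψ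
countermodel⇒⊬ ρ m Γ-sat ¬ψ (inj₂ (_ ∷ _ , premises , ⊢conj⇒ψ)) =
  sound ⊢conj⇒ψ ρ m (λ conj⇒ψ → ¬ψ (conj⇒ψ (conj-sat (All.map (All.lookup Γ-sat) premises))))

cons-↑ : m ≢ e → cons (↑ e) m
cons-↑ m≢e (e≤m , neg-↑e-m) = ≈⇒⊆ neg-↑ neg-↑e-m (λ m≤e → m≢e (≤-antisym m≤e e≤m))

⇒-trans : ⊢R L (α ⇒ β) → ⊢R L (β ⇒ γ) → ⊢R L (α ⇒ γ)
⇒-trans {α = α} {β} {γ} ⊢α⇒β ⊢β⇒γ = mp ⊢α⇒β (mp (mp ⊢β⇒γ (ax1 (β ⇒ γ) α)) (ax2 α β γ))

mp-under : ⊢R L (α ⇒ (β ⇒ γ)) → ⊢R L (α ⇒ β) → ⊢R L (α ⇒ γ)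
mp-under {α = α} {β} {γ} ⊢α⇒β⇒γ ⊢α⇒β = mp ⊢α⇒β (mp ⊢α⇒β⇒γ (ax2 α β γ))

gentle-explosion : ∀ φ ψ → ⊢R L (∘ φ ∧ (φ ∧ ~ φ) ⇒ ψ)
gentle-explosion φ ψ =
  mp-under (mp-under (⇒-trans (ax4 (∘ φ) (φ ∧ ~ φ)) (ax11 φ ψ))
                     (⇒-trans (ax5 (∘ φ) (φ ∧ ~ φ)) (ax4 φ (~ φ))))
           (⇒-trans (ax5 (∘ φ) (φ ∧ ~ φ)) (ax5 φ (~ φ)))

isLFI : ∀ L → IsLFI L
isLFI L =
    (p , q , countermodel⇒⊬ ρ (+ 0) (≤-refl ∷ inj₂ (inj₁ ≈-refl) ∷ []) λ ())
  , (p , q , countermodel⇒⊬ ρ (+ 1) (cons-↑ (λ ()) ∷ +≤+ z≤n ∷ []) λ ())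
  , (p , q , countermodel⇒⊬ ρ -[1+ 0 ] (cons-↑ (λ ()) ∷ inj₁ (λ ()) ∷ []) λ ())
  , λ φ ψ → inj₂ ((∘ φ ∷ φ ∷ ~ φ ∷ []) , All.tabulate (λ φ∈ → φ∈) , gentle-explosion φ ψ)
  where
  p q : Form
  p = var 0
  q = var 1
  ρ : ℕ → Value
  ρ 0 = ↑ (+ 0)
  ρ _ = ∅

proposition3p9 : IsLFI Cie × IsLFI Cbr
proposition3p9 = isLFI Cie , isLFI Cbr
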